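{- Let $G$ be a graph containing no induced subgraph isomorphic to $C_4$, with $\delta(G)\leq 3$. Then $\chi_{FF}(G)\geq \delta(G)+1$.
   Context: All graphs are finite, simple and undirected. $C_4$ is the cycle on 4 vertices. $\delta(G)$ is the minimum degree of $G$. A Grundy $k$-coloring of $G$ is a proper coloring with colors $\{1,\dots,k\}$ such that for any $i<j$, every vertex colored $j$ has a neighbor colored $i$; $\chi_{FF}(G)$ (the First-Fit or Grundy chromatic number) is the largest $k$ for which a Grundy $k$-coloring exists. -}

module Defs where

open import Data.Nat using (ℕ; zero; suc; _+_; _⊓_; _<_; _≤_)
open import Data.Fin using (Fin; toℕ) renaming (zero to fzero; suc to fsuc)
open import Data.Bool using (Bool; true; false)
open import Data.Product using (Σ; ∃; ∃-syntax; _×_)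
open import Relation.Binary.PropositionalEquality using (_≡_; _≢_)
open import Function using (_∘_)

record Graph (n : ℕ) : Set where
  field
    adj   : Fin n → Fin n → Bool
    sym   : ∀ u v → adj u v ≡ adj v u
    irrefl : ∀ v → adj v v ≡ false
open Graph public

Adj : ∀ {n} → Graph n → Fin n → Fin n → Set
Adj G u v = adj G u v ≡ true

countTrue : ∀ n → (Fin n → Bool) → ℕ
countTrue zero    f = 0
countTrue (suc n) f with f fzero
... | true  = suc (countTrue n (f ∘ fsuc))
... | false = countTrue n (f ∘ fsuc)

degree : ∀ {n} → Graph n → Fin n → ℕ
degree {n} G v = countTrue n (adj G v)

minOver : ∀ m → (Fin (suc m) → ℕ) → ℕ
minOver zero    f = f fzero
minOver (suc m) f = f fzero ⊓ minOver m (f ∘ fsuc)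

δ : ∀ {m} → Graph (suc m) → ℕ
δ {m} G = minOver m (degree G)

HasInducedC4 : ∀ {n} → Graph n → Set
HasInducedC4 {n} G = Σ (Fin n) λ a → Σ (Fin n) λ b → Σ (Fin n) λ c → Σ (Fin n) λ d →
  (a ≢ b × a ≢ c × a ≢ d × b ≢ c × b ≢ d × c ≢ d) ×
  (Adj G a b × Adj G b c × Adj G c d × Adj G d a) ×
  (adj G a c ≡ false × adj G b d ≡ false)

-- Grundy k-coloring (colors 0..k-1 stand for 1..k): proper, every color is
-- used, and each vertex of color j has a neighbour of every color i < j.
record GrundyColoring {n} (G : Graph n) (k : ℕ) : Set where
  field
    col    : Fin n → Fin k
    proper : ∀ u v → Adj G u v → col u ≢ col v
    onto   : ∀ (i : Fin k) → ∃[ v ] col v ≡ i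
    grundy : ∀ v (i : Fin k) → toℕ i < toℕ (col v) → ∃[ u ] (Adj G v u × col u ≡ i)

-- χ_FF(G) ≥ m  ⇔  there is a Grundy k-coloring with k ≥ m
-- (χ_FF is the largest such k; it exists since k ≤ n).
χFF≥ : ∀ {n} → Graph n → ℕ → Set
χFF≥ G m = ∃[ k ] (m ≤ k × GrundyColoring G k)

-- A partial coloring that is proper and satisfies the Grundy condition on the vertices it
-- colors extends, coloring the remaining vertices first-fit one at a time, to a Grundy
-- coloring of G. So χFF(G) ≥ d + 1 as soon as G contains a small configuration carrying such
-- a partial coloring with a vertex of color d: a vertex, an edge, a triangle or a P₄ (for
-- δ = 2 the only alternative is an induced C₄), and for δ = 3 an image of the binomial tree
-- of order 3. Around a triangle, C₄-freeness forces K₄ or a triangle whose vertices have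
-- pairwise non-adjacent further neighbors. Without triangles, C₄-freeness means girth ≥ 5,
-- and a breadth-first tree from any vertex contains the binomial tree, unless
-- a 5-cycle appears, which then supplies the missing leaf.
module Submission where

open import Defs
open import Data.Nat using (ℕ; suc; _≤_)
open import Relation.Nullary using (¬_)

open import Data.Bool using (Bool; true; false; not; _∧_)
import Data.Bool.Properties as Bool
open import Data.Empty using (⊥; ⊥-elim)
open import Data.Fin using (Fin; Fin′; toℕ; fromℕ; fromℕ<; inject)
  renaming (zero to fzero; suc to fsuc)
open import Data.Fin.Patterns using (0F; 1F; 2F; 3F)
open import Data.Fin.Properties using (_≟_; any?; <-cmp; toℕ-inject; toℕ-fromℕ; toℕ-fromℕ<;
  toℕ-injective; toℕ<n; ¬∀⟶∃¬-smallest)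
open import Data.List using (List; []; _∷_; length; allFin)
open import Data.List.Membership.Propositional using (_∈_; find)
open import Data.List.Membership.Propositional.Properties using (∈-allFin; ∈-AllPairs₂)
open import Data.List.Relation.Unary.All as All using (All; []; _∷_)
open import Data.List.Relation.Unary.AllPairs using (AllPairs; []; _∷_)
open import Data.List.Relation.Unary.Any using (Any; here; there)
open import Data.Maybe using (Maybe; just; nothing; fromMaybe)
open import Data.Maybe.Properties using (just-injective) renaming (≡-dec to ≡-dec-Maybe)
open import Data.Nat using (zero; _<_; z≤n; s≤s) renaming (_≟_ to _≟ℕ_)
open import Data.Nat.Properties using (≤-totalOrder; m⊓n≤m; m⊓n≤n; ≤-refl; ≤-trans; n≤1+n;
  ≤-pred; m<1+n⇒m<n∨m≡n; <-irrefl)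
open import Data.List.Extrema ≤-totalOrder using (argmax; f[xs]≤f[argmax])
open import Data.Product using (_×_; _,_; proj₁; proj₂; ∃-syntax)
open import Data.Sum using (_⊎_; inj₁; inj₂)
open import Function using (_∘_)
open import Relation.Binary using (tri<; tri≈; tri>)
open import Relation.Binary.PropositionalEquality using (_≡_; _≢_; ≢-sym; refl; cong; subst)
import Relation.Binary.PropositionalEquality as ≡
open import Relation.Nullary using (Dec; yes; no; does; contradiction)
open import Relation.Nullary.Decidable using (_×-dec_)

-- The test on i comes first so that the function reduces at fzero.
countTrue-remove : ∀ n (f : Fin n → Bool) j →
                   countTrue n f ≤ suc (countTrue n (λ i → not (does (i ≟ j)) ∧ f i))
countTrue-remove (suc n) f fzero with f fzero
... | true  = ≤-refl
... | false = n≤1+n _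
countTrue-remove (suc n) f (fsuc j) with f fzero
... | true  = s≤s (countTrue-remove n (f ∘ fsuc) j)
... | false = countTrue-remove n (f ∘ fsuc) j

fresh-true : ∀ {n} (f : Fin n → Bool) (xs : List (Fin n)) → length xs < countTrue n f →
             ∃[ i ] (f i ≡ true × All (i ≢_) xs)
fresh-true {suc n} f [] lt with f fzero in f0
... | true  = fzero , f0 , []
... | false with fresh-true (f ∘ fsuc) [] lt
...   | i , fi , [] = fsuc i , fi , []
fresh-true f (x ∷ xs) lt
  with fresh-true (λ i → not (does (i ≟ x)) ∧ f i) xs
                  (≤-pred (≤-trans lt (countTrue-remove _ f x)))
... | i , fi , i∉xs with i ≟ x | fi
...   | no i≢x | fi′ = i , fi′ , i≢x ∷ i∉xs

argmax-Fin : ∀ {n} (f : Fin n → ℕ) → Fin n → ∃[ w ] (∀ u → f u ≤ f w)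
argmax-Fin {n} f v =
  argmax f v (allFin n) , λ u → All.lookup (f[xs]≤f[argmax] v (allFin n)) (∈-allFin u)

minOver≤ : ∀ m (f : Fin (suc m) → ℕ) i → minOver m f ≤ f i
minOver≤ zero    f fzero    = ≤-refl
minOver≤ (suc m) f fzero    = m⊓n≤m _ _
minOver≤ (suc m) f (fsuc i) = ≤-trans (m⊓n≤n _ _) (minOver≤ m (f ∘ fsuc) i)

toℕ-inject-surjective : ∀ {k} {i : Fin k} {s} → s < toℕ i → ∃[ j ] (toℕ (inject {i = i} j) ≡ s)
toℕ-inject-surjective s<i = fromℕ< s<i , ≡.trans (toℕ-inject _) (toℕ-fromℕ< s<i)

module _ {n : ℕ} (G : Graph n) where

  open import Data.List.Membership.DecPropositional (_≟_ {n}) using (_∈?_)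

  infix 4 _~_ _≁_

  _~_ : Fin n → Fin n → Set
  u ~ v = Adj G u v

  _≁_ : Fin n → Fin n → Set
  u ≁ v = adj G u v ≡ false

  _~?_ : ∀ u v → Dec (u ~ v)
  u ~? v = adj G u v Bool.≟ true

  ~-sym : ∀ {u v} → u ~ v → v ~ u
  ~-sym {u} {v} u~v = ≡.trans (sym G v u) u~v

  ≁-sym : ∀ {u v} → u ≁ v → v ≁ u
  ≁-sym {u} {v} u≁v = ≡.trans (sym G v u) u≁v

  ≁-refl : ∀ {v} → v ≁ v
  ≁-refl {v} = irrefl G v

  ¬~⇒≁ : ∀ {u v} → ¬ u ~ v → u ≁ v
  ¬~⇒≁ {u} {v} ¬u~v with adj G u v
  ... | true  = ⊥-elim (¬u~v refl)
  ... | false = refl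

  ~-≁⇒≢ : ∀ {u v w} → w ~ u → w ≁ v → u ≢ v
  ~-≁⇒≢ w~u w≁v refl with () ← ≡.trans (≡.sym w~u) w≁v

  ~⇒≢ : ∀ {u v} → u ~ v → u ≢ v
  ~⇒≢ u~v = ≢-sym (~-≁⇒≢ u~v ≁-refl)

  fresh-neighbor : ∀ v (xs : List (Fin n)) → length xs < degree G v →
                   ∃[ u ] (v ~ u × All (u ≢_) xs)
  fresh-neighbor v = fresh-true (adj G v)

  PartialColoring : Set
  PartialColoring = Fin n → Maybe ℕ

  record IsPartialGrundy (c : PartialColoring) : Set where
    field
      proper : ∀ {u v a b} → c u ≡ just a → c v ≡ just b → u ~ v → a ≢ b
      grundy : ∀ {v a} → c v ≡ just a → ∀ i → i < a → ∃[ u ] (v ~ u × c u ≡ just i)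
  open IsPartialGrundy

  _⊑_ : PartialColoring → PartialColoring → Set
  c ⊑ c′ = ∀ {v a} → c v ≡ just a → c′ v ≡ just a

  Sees : PartialColoring → Fin n → ℕ → Set
  Sees c w t = ∃[ u ] (w ~ u × c u ≡ just t)

  sees? : ∀ c w t → Dec (Sees c w t)
  sees? c w t = any? λ u → (w ~? u) ×-dec ≡-dec-Maybe _≟ℕ_ (c u) (just t)

  colorBound : ∀ (c : PartialColoring) → Fin n → ∃[ M ] (∀ {u a} → c u ≡ just a → a < M)
  colorBound c w with argmax-Fin (fromMaybe 0 ∘ c) w
  ... | w* , max =
    suc (fromMaybe 0 (c w*)) , λ {u} cu≡a → s≤s (subst (_≤ _) (cong (fromMaybe 0) cu≡a) (max u))

  firstFit : ∀ c w → ∃[ t ] (¬ Sees c w t × ∀ s → s < t → Sees c w s)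
  firstFit c w with colorBound c w
  ... | M , bound
    with ¬∀⟶∃¬-smallest (suc M) (Sees c w ∘ toℕ) (sees? c w ∘ toℕ)
           (λ sees-all → let _ , _ , cu≡M = sees-all (fromℕ M) in
                         <-irrefl (toℕ-fromℕ M) (bound cu≡M))
  ... | t , unseen , seen-below = toℕ t , unseen , λ s s<t →
    let j , j≡s = toℕ-inject-surjective s<t in subst (Sees c w) j≡s (seen-below j)

  _[_≔_] : PartialColoring → Fin n → ℕ → PartialColoring
  (c [ w ≔ t ]) v with v ≟ w
  ... | yes _ = just t
  ... | no  _ = c v

  [≔]-here : ∀ c w t → (c [ w ≔ t ]) w ≡ just t
  [≔]-here c w t with w ≟ w
  ... | yes _  = refl
  ... | no w≢w = contradiction refl w≢w

  [≔]-just : ∀ c w t {v a} → (c [ w ≔ t ]) v ≡ just a → (v ≡ w × a ≡ t) ⊎ (v ≢ w × c v ≡ just a)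
  [≔]-just c w t {v} cv≡a with v ≟ w
  ... | yes v≡w = inj₁ (v≡w , ≡.sym (just-injective cv≡a))
  ... | no  v≢w = inj₂ (v≢w , cv≡a)

  ⊑-[≔] : ∀ c w t → c w ≡ nothing → c ⊑ (c [ w ≔ t ])
  ⊑-[≔] c w t cw≡nothing {v} cv≡a with v ≟ w
  ... | yes refl with () ← ≡.trans (≡.sym cw≡nothing) cv≡a
  ... | no  _    = cv≡a

  firstFit-isPartialGrundy : ∀ {c w t} → IsPartialGrundy c → c w ≡ nothing →
                             ¬ Sees c w t → (∀ s → s < t → Sees c w s) →
                             IsPartialGrundy (c [ w ≔ t ])
  firstFit-isPartialGrundy {c} {w} {t} isG cw≡nothing unseen seen-below = record
    { proper = λ cu≡a cv≡b → proper′ ([≔]-just c w t cu≡a) ([≔]-just c w t cv≡b)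
    ; grundy = grundy′ ∘ [≔]-just c w t
    }
    where
    Old-or-new : Fin n → ℕ → Set
    Old-or-new v a = (v ≡ w × a ≡ t) ⊎ (v ≢ w × c v ≡ just a)
    proper′ : ∀ {u v a b} → Old-or-new u a → Old-or-new v b → u ~ v → a ≢ b
    proper′ (inj₁ (refl , refl)) (inj₁ (refl , _))    w~w       = contradiction refl (~⇒≢ w~w)
    proper′ (inj₁ (refl , refl)) (inj₂ (_ , cv≡b))    w~v refl  = unseen (_ , w~v , cv≡b)
    proper′ (inj₂ (_ , cu≡a))    (inj₁ (refl , refl)) u~w refl  = unseen (_ , ~-sym u~w , cu≡a)
    proper′ (inj₂ (_ , cu≡a))    (inj₂ (_ , cv≡b))    u~v       = proper isG cu≡a cv≡b u~v
    grundy′ : ∀ {v a} → Old-or-new v a → ∀ i → i < a → ∃[ u ] (v ~ u × (c [ w ≔ t ]) u ≡ just i)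
    grundy′ (inj₁ (refl , refl)) i i<t with seen-below i i<t
    ... | u , w~u , cu≡i = u , w~u , ⊑-[≔] c w t cw≡nothing cu≡i
    grundy′ (inj₂ (_ , cv≡a)) i i<a with grundy isG cv≡a i i<a
    ... | u , v~u , cu≡i = u , v~u , ⊑-[≔] c w t cw≡nothing cu≡i

  Colored : PartialColoring → Fin n → Set
  Colored c v = ∃[ a ] (c v ≡ just a)

  extend : ∀ (vs : List (Fin n)) {c} → IsPartialGrundy c →
           ∃[ c′ ] (IsPartialGrundy c′ × c ⊑ c′ × All (Colored c′) vs)
  extend []       {c} isG = c , isG , (λ cv≡a → cv≡a) , []
  extend (w ∷ vs) {c} isG with c w in cw
  ... | just a with extend vs isG
  ...   | c′ , isG′ , c⊑c′ , colored = c′ , isG′ , c⊑c′ , (a , c⊑c′ cw) ∷ colored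
  extend (w ∷ vs) {c} isG | nothing with firstFit c w
  ...   | t , unseen , seen-below
    with extend vs (firstFit-isPartialGrundy isG cw unseen seen-below)
  ...     | c′ , isG′ , c⊑c′ , colored =
    c′ , isG′ , c⊑c′ ∘ ⊑-[≔] c w t cw , (t , c⊑c′ ([≔]-here c w t)) ∷ colored

  extend-total : ∀ {c} → IsPartialGrundy c →
                 ∃[ f ] (IsPartialGrundy (just ∘ f) × c ⊑ (just ∘ f))
  extend-total isG with extend (allFin n) isG
  ... | c′ , isG′ , c⊑c′ , colored =
    f , isG-f , λ cv≡a → ≡.trans (≡.sym (c′≡f _)) (c⊑c′ cv≡a)
    where
    f : Fin n → ℕ
    f v = proj₁ (All.lookup colored (∈-allFin v))
    c′≡f : ∀ v → c′ v ≡ just (f v)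
    c′≡f v = proj₂ (All.lookup colored (∈-allFin v))
    isG-f : IsPartialGrundy (just ∘ f)
    isG-f = record
      { proper = λ fu≡a fv≡b → proper isG′ (≡.trans (c′≡f _) fu≡a) (≡.trans (c′≡f _) fv≡b)
      ; grundy = λ fv≡a i i<a → let u , v~u , c′u≡i = grundy isG′ (≡.trans (c′≡f _) fv≡a) i i<a
                                in u , v~u , ≡.trans (≡.sym (c′≡f u)) c′u≡i
      }

  total⇒GrundyColoring : ∀ (f : Fin n → ℕ) → IsPartialGrundy (just ∘ f) →
                         ∀ {w} → (∀ u → f u ≤ f w) → GrundyColoring G (suc (f w))
  total⇒GrundyColoring f isG {w} f≤fw = record
    { col    = col
    ; proper = λ u v u~v cu≡cv → proper isG refl refl u~v
                 (≡.trans (≡.sym (toℕ-col u)) (≡.trans (cong toℕ cu≡cv) (toℕ-col v)))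
    ; onto   = λ i → onto (m<1+n⇒m<n∨m≡n (toℕ<n i))
    ; grundy = λ v i i<cv → neighbor-colored v i (subst (toℕ i <_) (toℕ-col v) i<cv)
    }
    where
    col : Fin n → Fin (suc (f w))
    col u = fromℕ< (s≤s (f≤fw u))
    toℕ-col : ∀ u → toℕ (col u) ≡ f u
    toℕ-col u = toℕ-fromℕ< (s≤s (f≤fw u))
    col≡ : ∀ {u i} → f u ≡ toℕ i → col u ≡ i
    col≡ {u} fu≡i = toℕ-injective (≡.trans (toℕ-col u) fu≡i)
    neighbor-colored : ∀ v i → toℕ i < f v → ∃[ u ] (v ~ u × col u ≡ i)
    neighbor-colored v i i<fv with grundy isG refl (toℕ i) i<fv
    ... | u , v~u , fu≡i = u , v~u , col≡ (just-injective fu≡i)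
    onto : ∀ {i} → toℕ i < f w ⊎ toℕ i ≡ f w → ∃[ u ] (col u ≡ i)
    onto {i} (inj₁ i<fw) = let u , _ , cu≡i = neighbor-colored w i i<fw in u , cu≡i
    onto     (inj₂ i≡fw) = w , col≡ (≡.sym i≡fw)

  χFF≥-partial : ∀ {c} → IsPartialGrundy c → ∀ {v d} → c v ≡ just d → χFF≥ G (suc d)
  χFF≥-partial isG {v} cv≡d with extend-total isG
  ... | f , isG-f , c⊑f with argmax-Fin f v
  ...   | w , f≤fw = suc (f w) , s≤s (subst (_≤ f w) (just-injective (c⊑f cv≡d)) (f≤fw v)) ,
                     total⇒GrundyColoring f isG-f f≤fw

  record GrundyClasses (k : ℕ) : Set where
    field
      class       : Fin k → List (Fin n)
      independent : ∀ i → AllPairs _≁_ (class i)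
      disjoint    : ∀ i (j : Fin′ i) → All (λ v → All (v ≢_) (class (inject j))) (class i)
      dominating  : ∀ i (j : Fin′ i) → All (λ v → Any (v ~_) (class (inject j))) (class i)

  module _ {k} (P : GrundyClasses k) where
    open GrundyClasses P

    below-disjoint : ∀ {i j v} → toℕ i < toℕ j → v ∈ class i → v ∈ class j → ⊥
    below-disjoint {i} {j} i<j v∈i v∈j with toℕ-inject-surjective i<j
    ... | j′ , j′≡i with toℕ-injective j′≡i
    ... | refl = All.lookup (All.lookup (disjoint j j′) v∈j) v∈i refl

    class-unique : ∀ {i j v} → v ∈ class i → v ∈ class j → i ≡ j
    class-unique {i} {j} v∈i v∈j with <-cmp i j
    ... | tri< i<j _ _ = ⊥-elim (below-disjoint i<j v∈i v∈j)
    ... | tri≈ _ i≡j _ = i≡j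
    ... | tri> _ _ j<i = ⊥-elim (below-disjoint j<i v∈j v∈i)

    classColoring : PartialColoring
    classColoring v with any? (λ i → v ∈? class i)
    ... | yes (i , _) = just (toℕ i)
    ... | no _        = nothing

    classColoring-∈ : ∀ {i v} → v ∈ class i → classColoring v ≡ just (toℕ i)
    classColoring-∈ {i} {v} v∈i with any? (λ i → v ∈? class i)
    ... | yes (j , v∈j) = cong (just ∘ toℕ) (class-unique v∈j v∈i)
    ... | no ∉classes   = contradiction (i , v∈i) ∉classes

    classColoring-just : ∀ {v a} → classColoring v ≡ just a → ∃[ i ] (v ∈ class i × toℕ i ≡ a)
    classColoring-just {v} cv≡a with any? (λ i → v ∈? class i)
    ... | yes (i , v∈i) = i , v∈i , just-injective cv≡a

    classColoring-isPartialGrundy : IsPartialGrundy classColoring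
    classColoring-isPartialGrundy = record { proper = proper′ ; grundy = grundy′ }
      where
      proper′ : ∀ {u v a b} → classColoring u ≡ just a → classColoring v ≡ just b → u ~ v → a ≢ b
      proper′ cu≡a cv≡b u~v refl with classColoring-just cu≡a | classColoring-just cv≡b
      ... | i , u∈i , i≡a | j , v∈j , j≡a with toℕ-injective (≡.trans i≡a (≡.sym j≡a))
      ... | refl with ∈-AllPairs₂ (independent i) u∈i v∈j
      ...   | inj₁ u≡v        = ~⇒≢ u~v u≡v
      ...   | inj₂ (inj₁ u≁v) = ~-≁⇒≢ u~v u≁v refl
      ...   | inj₂ (inj₂ v≁u) = ~-≁⇒≢ (~-sym u~v) v≁u refl
      grundy′ : ∀ {v a} → classColoring v ≡ just a →
                ∀ s → s < a → ∃[ u ] (v ~ u × classColoring u ≡ just s)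
      grundy′ cv≡a s s<a with classColoring-just cv≡a
      ... | i , v∈i , refl with toℕ-inject-surjective s<a
      ...   | j , j≡s with find (All.lookup (dominating i j) v∈i)
      ...     | u , u∈j , v~u = u , v~u , ≡.trans (classColoring-∈ u∈j) (cong just j≡s)

    χFF≥-classes : ∀ {i v} → v ∈ class i → χFF≥ G (suc (toℕ i))
    χFF≥-classes v∈i = χFF≥-partial classColoring-isPartialGrundy (classColoring-∈ v∈i)

  open GrundyClasses

  K₁⇒χFF≥1 : Fin n → χFF≥ G 1
  K₁⇒χFF≥1 z = χFF≥-classes P {0F} (here refl)
    where
    P : GrundyClasses 1
    P .class       0F = z ∷ []
    P .independent 0F = [] ∷ []
    P .disjoint    0F ()
    P .dominating  0F ()

  edge⇒χFF≥2 : ∀ {o z} → o ~ z → χFF≥ G 2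
  edge⇒χFF≥2 {o} {z} o~z = χFF≥-classes P {1F} (here refl)
    where
    P : GrundyClasses 2
    P .class       0F    = z ∷ []
    P .class       1F    = o ∷ []
    P .independent 0F    = [] ∷ []
    P .independent 1F    = [] ∷ []
    P .disjoint    0F ()
    P .disjoint    1F 0F = (~⇒≢ o~z ∷ []) ∷ []
    P .dominating  0F ()
    P .dominating  1F 0F = here o~z ∷ []

  -- z = z′ is allowed, making t, o, z a triangle.
  path⇒χFF≥3 : ∀ {t o z z′} → t ~ o → t ~ z → o ~ z′ → z ≁ z′ → t ≢ z′ → o ≢ z → χFF≥ G 3
  path⇒χFF≥3 {t} {o} {z} {z′} t~o t~z o~z′ z≁z′ t≢z′ o≢z = χFF≥-classes P {2F} (here refl)
    where
    P : GrundyClasses 3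
    P .class       0F    = z ∷ z′ ∷ []
    P .class       1F    = o ∷ []
    P .class       2F    = t ∷ []
    P .independent 0F    = (z≁z′ ∷ []) ∷ [] ∷ []
    P .independent 1F    = [] ∷ []
    P .independent 2F    = [] ∷ []
    P .disjoint    0F ()
    P .disjoint    1F 0F = (o≢z ∷ ~⇒≢ o~z′ ∷ []) ∷ []
    P .disjoint    2F 0F = (~⇒≢ t~z ∷ t≢z′ ∷ []) ∷ []
    P .disjoint    2F 1F = (~⇒≢ t~o ∷ []) ∷ []
    P .dominating  0F ()
    P .dominating  1F 0F = there (here o~z′) ∷ []
    P .dominating  2F 0F = here t~z ∷ []
    P .dominating  2F 1F = here t~o ∷ []

  -- The coloring h ↦ 3, t ↦ 2, oᵢ ↦ 1, zᵢ ↦ 0 along the binomial tree with edges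
  -- h─t, h─o₁, h─z₁, t─o₂, t─z₂, o₁─z₃, o₂─z₄. Its vertices may coincide in G, provided
  -- equally colored ones are non-adjacent and differently colored ones distinct.
  binomialTree⇒χFF≥4 : ∀ {h t o₁ o₂ z₁ z₂ z₃ z₄} →
    h ~ t → h ~ o₁ → h ~ z₁ → t ~ o₂ → t ~ z₂ → o₁ ~ z₃ → o₂ ~ z₄ →
    o₁ ≁ o₂ → AllPairs _≁_ (z₁ ∷ z₂ ∷ z₃ ∷ z₄ ∷ []) →
    All (h ≢_) (o₂ ∷ z₂ ∷ z₃ ∷ z₄ ∷ []) → All (t ≢_) (o₁ ∷ z₁ ∷ z₃ ∷ z₄ ∷ []) →
    All (o₁ ≢_) (z₁ ∷ z₂ ∷ z₄ ∷ []) → All (o₂ ≢_) (z₁ ∷ z₂ ∷ z₃ ∷ []) →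
    χFF≥ G 4
  binomialTree⇒χFF≥4 {h} {t} {o₁} {o₂} {z₁} {z₂} {z₃} {z₄}
    h~t h~o₁ h~z₁ t~o₂ t~z₂ o₁~z₃ o₂~z₄ o₁≁o₂ zs-independent
    (h≢o₂ ∷ h≢z₂ ∷ h≢z₃ ∷ h≢z₄ ∷ []) (t≢o₁ ∷ t≢z₁ ∷ t≢z₃ ∷ t≢z₄ ∷ [])
    (o₁≢z₁ ∷ o₁≢z₂ ∷ o₁≢z₄ ∷ []) (o₂≢z₁ ∷ o₂≢z₂ ∷ o₂≢z₃ ∷ []) =
    χFF≥-classes P {3F} (here refl)
    where
    P : GrundyClasses 4
    P .class       0F    = z₁ ∷ z₂ ∷ z₃ ∷ z₄ ∷ []
    P .class       1F    = o₁ ∷ o₂ ∷ []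
    P .class       2F    = t ∷ []
    P .class       3F    = h ∷ []
    P .independent 0F    = zs-independent
    P .independent 1F    = (o₁≁o₂ ∷ []) ∷ [] ∷ []
    P .independent 2F    = [] ∷ []
    P .independent 3F    = [] ∷ []
    P .disjoint    0F ()
    P .disjoint    1F 0F = (o₁≢z₁ ∷ o₁≢z₂ ∷ ~⇒≢ o₁~z₃ ∷ o₁≢z₄ ∷ [])
                         ∷ (o₂≢z₁ ∷ o₂≢z₂ ∷ o₂≢z₃ ∷ ~⇒≢ o₂~z₄ ∷ []) ∷ []
    P .disjoint    2F 0F = (t≢z₁ ∷ ~⇒≢ t~z₂ ∷ t≢z₃ ∷ t≢z₄ ∷ []) ∷ []
    P .disjoint    2F 1F = (t≢o₁ ∷ ~⇒≢ t~o₂ ∷ []) ∷ []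
    P .disjoint    3F 0F = (~⇒≢ h~z₁ ∷ h≢z₂ ∷ h≢z₃ ∷ h≢z₄ ∷ []) ∷ []
    P .disjoint    3F 1F = (~⇒≢ h~o₁ ∷ h≢o₂ ∷ []) ∷ []
    P .disjoint    3F 2F = (~⇒≢ h~t ∷ []) ∷ []
    P .dominating  0F ()
    P .dominating  1F 0F = there (there (here o₁~z₃)) ∷ there (there (there (here o₂~z₄))) ∷ []
    P .dominating  2F 0F = there (here t~z₂) ∷ []
    P .dominating  2F 1F = there (here t~o₂) ∷ []
    P .dominating  3F 0F = here h~z₁ ∷ []
    P .dominating  3F 1F = here h~o₁ ∷ []
    P .dominating  3F 2F = here h~t ∷ []

  triangleWithLeaves⇒χFF≥4 : ∀ {h t o zₕ zₜ zₒ} →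
    h ~ t → t ~ o → o ~ h → h ~ zₕ → t ~ zₜ → o ~ zₒ → AllPairs _≁_ (zₕ ∷ zₜ ∷ zₒ ∷ []) →
    All (h ≢_) (zₜ ∷ zₒ ∷ []) → All (t ≢_) (zₕ ∷ zₒ ∷ []) → All (o ≢_) (zₕ ∷ zₜ ∷ []) →
    χFF≥ G 4
  triangleWithLeaves⇒χFF≥4 h~t t~o o~h h~zₕ t~zₜ o~zₒ
    ((zₕ≁zₜ ∷ zₕ≁zₒ ∷ []) ∷ (zₜ≁zₒ ∷ []) ∷ [] ∷ [])
    (h≢zₜ ∷ h≢zₒ ∷ []) (t≢zₕ ∷ t≢zₒ ∷ []) (o≢zₕ ∷ o≢zₜ ∷ []) =
    binomialTree⇒χFF≥4 h~t (~-sym o~h) h~zₕ t~o t~zₜ o~zₒ o~zₒ ≁-refl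
      ((zₕ≁zₜ ∷ zₕ≁zₒ ∷ zₕ≁zₒ ∷ []) ∷ (zₜ≁zₒ ∷ zₜ≁zₒ ∷ []) ∷ (≁-refl ∷ []) ∷ [] ∷ [])
      (~⇒≢ (~-sym o~h) ∷ h≢zₜ ∷ h≢zₒ ∷ h≢zₒ ∷ [])
      (~⇒≢ t~o ∷ t≢zₕ ∷ t≢zₒ ∷ t≢zₒ ∷ [])
      (o≢zₕ ∷ o≢zₜ ∷ ~⇒≢ o~zₒ ∷ [])
      (o≢zₕ ∷ o≢zₜ ∷ ~⇒≢ o~zₒ ∷ [])

  K₄⇒χFF≥4 : ∀ {p q r s} → p ~ q → p ~ r → p ~ s → q ~ r → q ~ s → r ~ s → χFF≥ G 4
  K₄⇒χFF≥4 p~q p~r p~s q~r q~s r~s =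
    triangleWithLeaves⇒χFF≥4 p~q q~r (~-sym p~r) p~s q~s r~s
      ((≁-refl ∷ ≁-refl ∷ []) ∷ (≁-refl ∷ []) ∷ [] ∷ [])
      (~⇒≢ p~s ∷ ~⇒≢ p~s ∷ []) (~⇒≢ q~s ∷ ~⇒≢ q~s ∷ []) (~⇒≢ r~s ∷ ~⇒≢ r~s ∷ [])

  minDegree≥1⇒χFF≥2 : (∀ v → 1 ≤ degree G v) → Fin n → χFF≥ G 2
  minDegree≥1⇒χFF≥2 deg v = let _ , v~u , _ = fresh-neighbor v [] (deg v) in edge⇒χFF≥2 v~u

  module _ (noC4 : ¬ HasInducedC4 G) where

    no-induced-C4 : ∀ {a b c d} → a ≢ c → b ≢ d →
                    a ~ b → b ~ c → c ~ d → d ~ a → a ≁ c → b ≁ d → ⊥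
    no-induced-C4 a≢c b≢d a~b b~c c~d d~a a≁c b≁d =
      noC4 (_ , _ , _ , _ , (~⇒≢ a~b , a≢c , ~⇒≢ (~-sym d~a) , ~⇒≢ b~c , b≢d , ~⇒≢ c~d) ,
                            (a~b , b~c , c~d , d~a) , (a≁c , b≁d))

    chord : ∀ {a b c d} → a ≢ c → b ≢ d → a ~ b → b ~ c → c ~ d → d ~ a → b ≁ d → a ~ c
    chord {a} {c = c} a≢c b≢d a~b b~c c~d d~a b≁d with adj G a c in a?c
    ... | true  = refl
    ... | false = ⊥-elim (no-induced-C4 a≢c b≢d a~b b~c c~d d~a a?c b≁d)

    minDegree≥2⇒χFF≥3 : (∀ v → 2 ≤ degree G v) → Fin n → χFF≥ G 3
    minDegree≥2⇒χFF≥3 deg x with fresh-neighbor x (x ∷ []) (deg x)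
    ... | b , x~b , _ with fresh-neighbor x (b ∷ []) (deg x)
    ... | c , x~c , c≢b ∷ [] with adj G b c in b?c
    ... | true  = path⇒χFF≥3 x~b x~c b?c ≁-refl (~⇒≢ x~c) (~⇒≢ b?c)
    ... | false with fresh-neighbor c (x ∷ []) (deg c)
    ...   | y , c~y , y≢x ∷ [] with adj G y x in y?x
    ...     | true  = path⇒χFF≥3 x~c (~-sym y?x) c~y ≁-refl (~⇒≢ (~-sym y?x)) (~⇒≢ c~y)
    ...     | false with adj G y b in y?b
    ...       | false = path⇒χFF≥3 (~-sym x~c) c~y x~b y?b c≢b (≢-sym y≢x)
    ...       | true  = ⊥-elim (no-induced-C4 (≢-sym y≢x) (≢-sym c≢b)
                                  x~b (~-sym y?b) (~-sym c~y) (~-sym x~c) (≁-sym y?x) b?c)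

    module _ (deg : ∀ v → 3 ≤ degree G v) where

      neighbor : ∀ v → ∃[ u ] (v ~ u)
      neighbor v = let u , v~u , _ = fresh-neighbor v [] (≤-trans (s≤s z≤n) (deg v)) in u , v~u

      neighbor≢ : ∀ v w → ∃[ u ] (v ~ u × u ≢ w)
      neighbor≢ v w with fresh-neighbor v (w ∷ []) (≤-trans (s≤s (s≤s z≤n)) (deg v))
      ... | u , v~u , u≢w ∷ [] = u , v~u , u≢w

      neighbor≢₂ : ∀ v w w′ → ∃[ u ] (v ~ u × u ≢ w × u ≢ w′)
      neighbor≢₂ v w w′ with fresh-neighbor v (w ∷ w′ ∷ []) (deg v)
      ... | u , v~u , u≢w ∷ u≢w′ ∷ [] = u , v~u , u≢w , u≢w′

      diamond⇒χFF≥4 : ∀ {x a b c} → x ~ a → x ~ b → x ~ c → a ~ b → b ~ c → a ≁ c → a ≢ c →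
                      χFF≥ G 4
      diamond⇒χFF≥4 {x} {a} {b} {c} x~a x~b x~c a~b b~c a≁c a≢c with neighbor≢₂ c x b
      ... | d , c~d , d≢x , d≢b with adj G a d in a?d
      ... | false = triangleWithLeaves⇒χFF≥4 (~-sym x~c) x~b b~c c~d x~a (~-sym a~b)
                      ((≁-sym a?d ∷ ≁-sym a?d ∷ []) ∷ (≁-refl ∷ []) ∷ [] ∷ [])
                      (≢-sym a≢c ∷ ≢-sym a≢c ∷ []) (≢-sym d≢x ∷ ~⇒≢ x~a ∷ [])
                      (≢-sym d≢b ∷ ~⇒≢ (~-sym a~b) ∷ [])
      ... | true  = K₄⇒χFF≥4 x~a x~b x~d a~b a?d b~d
        where
        x~d : x ~ d
        x~d = chord (≢-sym d≢x) a≢c x~a a?d (~-sym c~d) (~-sym x~c) a≁c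
        b~d : b ~ d
        b~d = chord (≢-sym d≢b) a≢c (~-sym a~b) a?d (~-sym c~d) (~-sym b~c) a≁c

      module _ {x a b c} (x~a : x ~ a) (x~b : x ~ b) (a~b : a ~ b) (x~c : x ~ c)
               (c≁a : c ≁ a) (c≁b : c ≁ b) (c≢a : c ≢ a) (c≢b : c ≢ b) where

        paw-commonNeighbor⇒χFF≥4 : ∀ {d} → a ~ d → b ~ d → d ≢ x → χFF≥ G 4
        paw-commonNeighbor⇒χFF≥4 {d} a~d b~d d≢x with adj G d c in d?c
        ... | true  = K₄⇒χFF≥4 x~a x~b x~d a~b a~d b~d
          where
          x~d : x ~ d
          x~d = chord (≢-sym d≢x) (≢-sym c≢a) x~a a~d d?c (~-sym x~c) (≁-sym c≁a)
        ... | false = triangleWithLeaves⇒χFF≥4 x~b (~-sym a~b) (~-sym x~a) x~c b~d a~d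
                        ((≁-sym d?c ∷ ≁-sym d?c ∷ []) ∷ (≁-refl ∷ []) ∷ [] ∷ [])
                        (≢-sym d≢x ∷ ≢-sym d≢x ∷ []) (≢-sym c≢b ∷ ~⇒≢ b~d ∷ [])
                        (≢-sym c≢a ∷ ~⇒≢ a~d ∷ [])

        paw⇒χFF≥4 : χFF≥ G 4
        paw⇒χFF≥4 with neighbor≢₂ a x b
        ... | d , a~d , d≢x , d≢b with adj G b d in b?d
        ... | true  = paw-commonNeighbor⇒χFF≥4 a~d b?d d≢x
        ... | false with neighbor≢₂ b x a
        ...   | y , b~y , y≢x , y≢a with adj G a y in a?y
        ...     | true  = paw-commonNeighbor⇒χFF≥4 a?y b~y y≢x
        ...     | false with adj G d y in d?y
        ...       | true  = ⊥-elim (no-induced-C4 (≢-sym y≢a) d≢b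
                                      a~d d?y (~-sym b~y) (~-sym a~b) a?y (≁-sym b?d))
        ...       | false with adj G d c in d?c | adj G y c in y?c
        ...         | true  | _     = diamond⇒χFF≥4 x~b x~a x~d (~-sym a~b) a~d b?d (≢-sym d≢b)
          where
          x~d : x ~ d
          x~d = chord (≢-sym d≢x) (≢-sym c≢a) x~a a~d d?c (~-sym x~c) (≁-sym c≁a)
        ...         | false | true  = diamond⇒χFF≥4 x~a x~b x~y a~b b~y a?y (≢-sym y≢a)
          where
          x~y : x ~ y
          x~y = chord (≢-sym y≢x) (≢-sym c≢b) x~b b~y y?c (~-sym x~c) (≁-sym c≁b)
        ...         | false | false =
          triangleWithLeaves⇒χFF≥4 x~b (~-sym a~b) (~-sym x~a) x~c b~y a~d
            ((≁-sym y?c ∷ ≁-sym d?c ∷ []) ∷ (≁-sym d?y ∷ []) ∷ [] ∷ [])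
            (≢-sym y≢x ∷ ≢-sym d≢x ∷ []) (≢-sym c≢b ∷ ≢-sym d≢b ∷ []) (≢-sym c≢a ∷ ≢-sym y≢a ∷ [])

      hasTriangle⇒χFF≥4 : ∀ {x a b} → x ~ a → a ~ b → b ~ x → χFF≥ G 4
      hasTriangle⇒χFF≥4 {x} {a} {b} x~a a~b b~x with neighbor≢₂ x a b
      ... | c , x~c , c≢a , c≢b with adj G c a in c?a | adj G c b in c?b
      ... | true  | true  = K₄⇒χFF≥4 x~a (~-sym b~x) x~c a~b (~-sym c?a) (~-sym c?b)
      ... | true  | false = diamond⇒χFF≥4 (~-sym b~x) x~a x~c (~-sym a~b) (~-sym c?a)
                              (≁-sym c?b) (≢-sym c≢b)
      ... | false | true  = diamond⇒χFF≥4 x~a (~-sym b~x) x~c a~b (~-sym c?b)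
                              (≁-sym c?a) (≢-sym c≢a)
      ... | false | false = paw⇒χFF≥4 x~a (~-sym b~x) a~b x~c c?a c?b c≢a c≢b

      module _ (noTriangle : ∀ {x y z} → x ~ y → y ~ z → z ~ x → ⊥) where

        no-C4 : ∀ {a b c d} → a ≢ c → b ≢ d → a ~ b → b ~ c → c ~ d → d ~ a → ⊥
        no-C4 a≢c b≢d a~b b~c c~d d~a = no-induced-C4 a≢c b≢d a~b b~c c~d d~a
          (¬~⇒≁ λ a~c → noTriangle a~b b~c (~-sym a~c)) (¬~⇒≁ λ b~d → noTriangle b~c c~d (~-sym b~d))

        path₃⇒≢ : ∀ {u v w y} → u ~ v → v ~ w → w ~ y → u ≢ y
        path₃⇒≢ u~v v~w w~u refl = noTriangle u~v v~w w~u

        path₄⇒≁ : ∀ {u v w y} → u ≢ w → v ≢ y → u ~ v → v ~ w → w ~ y → u ≁ y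
        path₄⇒≁ u≢w v≢y u~v v~w w~y = ¬~⇒≁ λ u~y → no-C4 u≢w v≢y u~v v~w w~y (~-sym u~y)

        -- The binomial tree rooted at x, with t = c, o₁ = b, o₂ = c₁ and leaves a, c₂, b′, d:
        -- girth ≥ 5 forces all its conditions except the three non-adjacencies assumed.
        tree⇒χFF≥4 : ∀ {x a b c c₁ c₂ b′ d} →
          x ~ a → x ~ b → x ~ c → a ≢ b → a ≢ c → b ≢ c →
          c ~ c₁ → c ~ c₂ → c₁ ≢ x → c₂ ≢ x → c₁ ≢ c₂ → b ~ b′ → b′ ≢ x → c₁ ~ d → d ≢ c →
          a ≁ d → b′ ≁ c₂ → b′ ≁ d → χFF≥ G 4
        tree⇒χFF≥4 {x} {a} {b} {c} {c₁} {c₂} {b′} {d}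
          x~a x~b x~c a≢b a≢c b≢c c~c₁ c~c₂ c₁≢x c₂≢x c₁≢c₂ b~b′ b′≢x c₁~d d≢c a≁d b′≁c₂ b′≁d =
          binomialTree⇒χFF≥4 x~c x~b x~a c~c₁ c~c₂ b~b′ c₁~d b≁c₁
            ((a≁c₂ ∷ a≁b′ ∷ a≁d ∷ []) ∷ (≁-sym b′≁c₂ ∷ c₂≁d ∷ []) ∷ (b′≁d ∷ []) ∷ [] ∷ [])
            (≢-sym c₁≢x ∷ ≢-sym c₂≢x ∷ ≢-sym b′≢x ∷ path₃⇒≢ x~c c~c₁ c₁~d ∷ [])
            (≢-sym b≢c ∷ ≢-sym a≢c ∷ path₃⇒≢ (~-sym x~c) x~b b~b′ ∷ ≢-sym d≢c ∷ [])
            (≢-sym a≢b ∷ path₃⇒≢ (~-sym x~b) x~c c~c₂ ∷ ≢-sym (~-≁⇒≢ c₁~d (≁-sym b≁c₁)) ∷ [])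
            (path₃⇒≢ (~-sym c~c₁) (~-sym x~c) x~a ∷ c₁≢c₂ ∷ ≢-sym (~-≁⇒≢ b~b′ b≁c₁) ∷ [])
          where
          b≁c₁ : b ≁ c₁
          b≁c₁ = path₄⇒≁ b≢c (≢-sym c₁≢x) (~-sym x~b) x~c c~c₁
          a≁c₂ : a ≁ c₂
          a≁c₂ = path₄⇒≁ a≢c (≢-sym c₂≢x) (~-sym x~a) x~c c~c₂
          a≁b′ : a ≁ b′
          a≁b′ = path₄⇒≁ a≢b (≢-sym b′≢x) (~-sym x~a) x~b b~b′
          c₂≁d : c₂ ≁ d
          c₂≁d = path₄⇒≁ (≢-sym c₁≢c₂) (≢-sym d≢c) (~-sym c~c₂) c~c₁ c₁~d

        -- If a ~ d, the pentagon x a d c₁ c lets d play the role of b′, below a.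
        treeOrPentagon⇒χFF≥4 : ∀ {x a b c c₁ c₂ b′ d} →
          x ~ a → x ~ b → x ~ c → a ≢ b → a ≢ c → b ≢ c →
          c ~ c₁ → c ~ c₂ → c₁ ≢ x → c₂ ≢ x → c₁ ≢ c₂ → b ~ b′ → b′ ≢ x → c₁ ~ d → d ≢ c →
          b′ ≁ c₂ → b′ ≁ d → χFF≥ G 4
        treeOrPentagon⇒χFF≥4 {a = a} {d = d}
          x~a x~b x~c a≢b a≢c b≢c c~c₁ c~c₂ c₁≢x c₂≢x c₁≢c₂ b~b′ b′≢x c₁~d d≢c b′≁c₂ b′≁d
          with adj G a d in a?d
        ... | false = tree⇒χFF≥4 x~a x~b x~c a≢b a≢c b≢c c~c₁ c~c₂ c₁≢x c₂≢x c₁≢c₂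
                        b~b′ b′≢x c₁~d d≢c a?d b′≁c₂ b′≁d
        ... | true  = tree⇒χFF≥4 x~b x~a x~c (≢-sym a≢b) b≢c a≢c c~c₁ c~c₂ c₁≢x c₂≢x c₁≢c₂
                        a?d (path₃⇒≢ (~-sym c₁~d) (~-sym c~c₁) (~-sym x~c)) c₁~d d≢c
                        (path₄⇒≁ (≢-sym a≢b) (path₃⇒≢ x~c c~c₁ c₁~d) (~-sym x~b) x~a a?d)
                        (path₄⇒≁ d≢c c₁≢c₂ (~-sym c₁~d) (~-sym c~c₁) c~c₂) ≁-refl

        triangleFree⇒χFF≥4 : Fin n → χFF≥ G 4
        triangleFree⇒χFF≥4 x with neighbor x
        ... | c , x~c with neighbor≢ x c
        ... | b , x~b , b≢c with neighbor≢₂ x c b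
        ... | a , x~a , a≢c , a≢b with neighbor≢ c x
        ... | c₁ , c~c₁ , c₁≢x with neighbor≢₂ c x c₁
        ... | c₂ , c~c₂ , c₂≢x , c₂≢c₁ with neighbor≢ b x
        ... | b′ , b~b′ , b′≢x with adj G b′ c₂ in b′?c₂
        ... | true  = tree⇒χFF≥4 x~a x~b x~c a≢b a≢c b≢c c~c₂ c~c₁ c₂≢x c₁≢x c₂≢c₁ b~b′ b′≢x
                        (~-sym b′?c₂) b′≢c (path₄⇒≁ a≢b (≢-sym b′≢x) (~-sym x~a) x~b b~b′)
                        (path₄⇒≁ b′≢c c₂≢c₁ b′?c₂ (~-sym c~c₂) c~c₁) ≁-refl
          where
          b′≢c : b′ ≢ c
          b′≢c = path₃⇒≢ (~-sym b~b′) (~-sym x~b) x~c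
        ... | false with neighbor≢ c₁ c
        ...   | d₁ , c₁~d₁ , d₁≢c with neighbor≢₂ c₁ c d₁
        ...   | d₂ , c₁~d₂ , d₂≢c , d₂≢d₁ with adj G b′ d₁ in b′?d₁ | adj G b′ d₂ in b′?d₂
        ...   | false | _     = treeOrPentagon⇒χFF≥4 x~a x~b x~c a≢b a≢c b≢c c~c₁ c~c₂ c₁≢x c₂≢x
                                  (≢-sym c₂≢c₁) b~b′ b′≢x c₁~d₁ d₁≢c b′?c₂ b′?d₁
        ...   | true  | false = treeOrPentagon⇒χFF≥4 x~a x~b x~c a≢b a≢c b≢c c~c₁ c~c₂ c₁≢x c₂≢x
                                  (≢-sym c₂≢c₁) b~b′ b′≢x c₁~d₂ d₂≢c b′?c₂ b′?d₂
        ...   | true  | true  =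
          ⊥-elim (no-C4 b′≢c₁ (≢-sym d₂≢d₁) b′?d₁ (~-sym c₁~d₁) c₁~d₂ (~-sym b′?d₂))
          where
          b′≢c₁ : b′ ≢ c₁
          b′≢c₁ = ~-≁⇒≢ b~b′ (path₄⇒≁ b≢c (≢-sym c₁≢x) (~-sym x~b) x~c c~c₁)

      minDegree≥3⇒χFF≥4 : Fin n → χFF≥ G 4
      minDegree≥3⇒χFF≥4 v with any? (λ x → any? λ a → any? λ b → x ~? a ×-dec a ~? b ×-dec b ~? x)
      ... | yes (_ , _ , _ , x~a , a~b , b~x) = hasTriangle⇒χFF≥4 x~a a~b b~x
      ... | no ∄triangle =
        triangleFree⇒χFF≥4 (λ x~a a~b b~x → ∄triangle (_ , _ , _ , x~a , a~b , b~x)) v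

theorem10 : ∀ {m} (G : Graph (suc m)) → ¬ HasInducedC4 G → δ G ≤ 3 → χFF≥ G (suc (δ G))
theorem10 {m} G noC4 δ≤3 = go (δ G) (minOver≤ m (degree G)) δ≤3
  where
  go : ∀ d → (∀ v → d ≤ degree G v) → d ≤ 3 → χFF≥ G (suc d)
  go 0 _   _ = K₁⇒χFF≥1 G fzero
  go 1 deg _ = minDegree≥1⇒χFF≥2 G deg fzero
  go 2 deg _ = minDegree≥2⇒χFF≥3 G noC4 deg fzero
  go 3 deg _ = minDegree≥3⇒χFF≥4 G noC4 deg fzero
  go (suc (suc (suc (suc _)))) _ (s≤s (s≤s (s≤s ())))
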